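{- For all formulas $\alpha,\beta$ of the language $\{\wedge,\vee,\neg,\square,\bot\}$, the following hold in ${\bf ND}_{\cal TML}$: (i) $\vdash\square(\alpha\vee\neg\square\alpha)$; (ii) $\neg\square\alpha\wedge\alpha\dashv\vdash\neg\alpha\wedge\alpha$; (iii) $\vdash\square\alpha\vee\neg\square\alpha$; (iv) $\square\alpha\wedge\neg\square\alpha\dashv\vdash\bot$; (v) $\square(\square\alpha\wedge\square\beta)\dashv\vdash\square\alpha\wedge\square\beta$; (vi) $\square(\square\alpha\vee\square\beta)\dashv\vdash\square\alpha\vee\square\beta$; (vii) $\square\alpha\vee\neg\alpha\dashv\vdash\alpha\vee\neg\alpha$; (viii) $\square\square\alpha\dashv\vdash\square\alpha$; (ix) $\square(\alpha\wedge\beta)\dashv\vdash\square\alpha\wedge\square\beta$; (x) $\square(\alpha\vee\square\beta)\dashv\vdash\square\alpha\vee\square\beta$; (xi) $\square\neg\square\alpha\dashv\vdash\neg\square\alpha$; (xii) $\alpha\wedge\square\neg\alpha\dashv\vdash\bot$.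
   Context: Formulas are built from a denumerable set of propositional variables and the constant $\bot$ using binary $\wedge,\vee$ and unary $\neg,\square$. The natural deduction system ${\bf ND}_{\cal TML}$ has the following rules (brackets $[\cdot]$ indicate assumptions discharged by the rule): MA: infer $\phi\vee\neg\square\phi$ from no premises. $\wedge$I: from $\phi$ and $\psi$ infer $\phi\wedge\psi$; $\wedge$E$_1$, $\wedge$E$_2$: from $\phi\wedge\psi$ infer $\phi$, resp. $\psi$. $\neg\wedge$I$_1$: from $\neg\phi$ infer $\neg(\phi\wedge\psi)$; $\neg\wedge$I$_2$: from $\neg\psi$ infer $\neg(\phi\wedge\psi)$; $\neg\wedge$E: from $\neg(\phi\wedge\psi)$, a deduction of $\chi$ from $[\neg\phi]$ and a deduction of $\chi$ from $[\neg\psi]$, infer $\chi$. $\vee$I$_1$, $\vee$I$_2$: from $\phi$ (resp. $\psi$) infer $\phi\vee\psi$; $\vee$E: from $\phi\vee\psi$, a deduction of $\chi$ from $[\phi]$ and a deduction of $\chi$ from $[\psi]$, infer $\chi$. $\neg\vee$I: from $\neg\phi$ and $\neg\psi$ infer $\neg(\phi\vee\psi)$; $\neg\vee$E$_1$, $\neg\vee$E$_2$: from $\neg(\phi\vee\psi)$ infer $\neg\phi$, resp. $\neg\psi$. $\neg\neg$I: from $\phi$ infer $\neg\neg\phi$; $\neg\neg$E: from $\neg\neg\phi$ infer $\phi$. $\square$I: from $\phi$ and a deduction of $\bot$ from $[\neg\phi]$, infer $\square\phi$; $\square$E: from $\square\phi$ infer $\phi$. $\neg\square$I: from $\neg\phi$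 infer $\neg\square\phi$; $\neg\square$E: from $\neg\square\phi$ and $\phi$ infer $\neg\phi$. $\bot$I: from $\neg\phi\wedge\square\phi$ infer $\bot$; $\bot$E: from $\bot$ infer any formula. $\Gamma\vdash\alpha$ means there is a deduction of $\alpha$ all of whose open assumptions belong to $\Gamma$; $\vdash\alpha$ means a deduction with no open assumptions; $\alpha\dashv\vdash\beta$ means $\alpha\vdash\beta$ and $\beta\vdash\alpha$. -}

module Defs where

open import Data.Nat using (ℕ)
open import Data.List using (List; []; _∷_)
open import Data.List.Membership.Propositional using (_∈_)
open import Data.Product using (_×_)

data Form : Set where
  var  : ℕ → Form
  ⊥'   : Form
  _∧'_ : Form → Form → Form
  _∨'_ : Form → Form → Form
  ¬'_  : Form → Form
  □_   : Form → Form

infixr 6 _∧'_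
infixr 5 _∨'_
infix  8 ¬'_ □_
infix  3 _⊢_ _⊣⊢_

-- Γ ⊢ φ : there is a deduction of φ in ND_TML whose open assumptions all
-- belong to Γ.  Discharging an assumption ψ in a subdeduction corresponds
-- to extending the context with ψ.
data _⊢_ (Γ : List Form) : Form → Set where
  ass   : ∀ {φ} → φ ∈ Γ → Γ ⊢ φ
  MA    : ∀ {φ} → Γ ⊢ φ ∨' ¬' □ φ
  ∧I    : ∀ {φ ψ} → Γ ⊢ φ → Γ ⊢ ψ → Γ ⊢ φ ∧' ψ
  ∧E₁   : ∀ {φ ψ} → Γ ⊢ φ ∧' ψ → Γ ⊢ φ
  ∧E₂   : ∀ {φ ψ} → Γ ⊢ φ ∧' ψ → Γ ⊢ ψ
  ¬∧I₁  : ∀ {φ ψ} → Γ ⊢ ¬' φ → Γ ⊢ ¬' (φ ∧' ψ)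
  ¬∧I₂  : ∀ {φ ψ} → Γ ⊢ ¬' ψ → Γ ⊢ ¬' (φ ∧' ψ)
  ¬∧E   : ∀ {φ ψ χ} → Γ ⊢ ¬' (φ ∧' ψ) → (¬' φ ∷ Γ) ⊢ χ → (¬' ψ ∷ Γ) ⊢ χ → Γ ⊢ χ
  ∨I₁   : ∀ {φ ψ} → Γ ⊢ φ → Γ ⊢ φ ∨' ψ
  ∨I₂   : ∀ {φ ψ} → Γ ⊢ ψ → Γ ⊢ φ ∨' ψ
  ∨E    : ∀ {φ ψ χ} → Γ ⊢ φ ∨' ψ → (φ ∷ Γ) ⊢ χ → (ψ ∷ Γ) ⊢ χ → Γ ⊢ χ
  ¬∨I   : ∀ {φ ψ} → Γ ⊢ ¬' φ → Γ ⊢ ¬' ψ → Γ ⊢ ¬' (φ ∨' ψ)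
  ¬∨E₁  : ∀ {φ ψ} → Γ ⊢ ¬' (φ ∨' ψ) → Γ ⊢ ¬' φ
  ¬∨E₂  : ∀ {φ ψ} → Γ ⊢ ¬' (φ ∨' ψ) → Γ ⊢ ¬' ψ
  ¬¬I   : ∀ {φ} → Γ ⊢ φ → Γ ⊢ ¬' ¬' φ
  ¬¬E   : ∀ {φ} → Γ ⊢ ¬' ¬' φ → Γ ⊢ φ
  □I    : ∀ {φ} → Γ ⊢ φ → (¬' φ ∷ Γ) ⊢ ⊥' → Γ ⊢ □ φ
  □E    : ∀ {φ} → Γ ⊢ □ φ → Γ ⊢ φ
  ¬□I   : ∀ {φ} → Γ ⊢ ¬' φ → Γ ⊢ ¬' □ φ
  ¬□E   : ∀ {φ} → Γ ⊢ ¬' □ φ → Γ ⊢ φ → Γ ⊢ ¬' φ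
  ⊥I    : ∀ {φ} → Γ ⊢ ¬' φ ∧' □ φ → Γ ⊢ ⊥'
  ⊥E    : ∀ {φ} → Γ ⊢ ⊥' → Γ ⊢ φ

⊢_ : Form → Set
⊢ α = [] ⊢ α

infix 3 ⊢_

_⊣⊢_ : Form → Form → Set
α ⊣⊢ β = ((α ∷ []) ⊢ β) × ((β ∷ []) ⊢ α)

{-# OPTIONS --safe #-}
module Submission where

-- TML is paraconsistent: φ and ¬' φ need not clash, and □ φ records that φ
-- holds and ¬' φ is refutable (□I, ⊥I). Boxed and negated-boxed formulas
-- clash with their own negation, and this survives ∧ and ∨, so □ can be
-- reintroduced over them; that gives (iv), (v), (vi), (viii) and (xi).
-- MA instantiated at ¬' □ α yields excluded middle for □ α, which is (iii)
-- and drives (vii) and (x); the remaining items are direct derivations.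

open import Defs
open import Data.Product using (_×_; _,_)
open import Data.List using (List; _∷_)
open import Data.List.Relation.Unary.Any using (here; there)
open import Data.List.Relation.Binary.Subset.Propositional using (_⊆_)
open import Data.List.Relation.Binary.Subset.Propositional.Properties using (∷⁺ʳ; xs⊆x∷xs)
open import Relation.Binary.PropositionalEquality using (refl)

private
  variable
    Γ Δ : List Form
    φ ψ χ : Form

⊢-mono : Γ ⊆ Δ → Γ ⊢ φ → Δ ⊢ φ
⊢-mono s (ass x)     = ass (s x)
⊢-mono s MA          = MA
⊢-mono s (∧I d e)    = ∧I (⊢-mono s d) (⊢-mono s e)
⊢-mono s (∧E₁ d)     = ∧E₁ (⊢-mono s d)
⊢-mono s (∧E₂ d)     = ∧E₂ (⊢-mono s d)
⊢-mono s (¬∧I₁ d)    = ¬∧I₁ (⊢-mono s d)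
⊢-mono s (¬∧I₂ d)    = ¬∧I₂ (⊢-mono s d)
⊢-mono s (¬∧E d e f) = ¬∧E (⊢-mono s d) (⊢-mono (∷⁺ʳ _ s) e) (⊢-mono (∷⁺ʳ _ s) f)
⊢-mono s (∨I₁ d)     = ∨I₁ (⊢-mono s d)
⊢-mono s (∨I₂ d)     = ∨I₂ (⊢-mono s d)
⊢-mono s (∨E d e f)  = ∨E (⊢-mono s d) (⊢-mono (∷⁺ʳ _ s) e) (⊢-mono (∷⁺ʳ _ s) f)
⊢-mono s (¬∨I d e)   = ¬∨I (⊢-mono s d) (⊢-mono s e)
⊢-mono s (¬∨E₁ d)    = ¬∨E₁ (⊢-mono s d)
⊢-mono s (¬∨E₂ d)    = ¬∨E₂ (⊢-mono s d)
⊢-mono s (¬¬I d)     = ¬¬I (⊢-mono s d)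
⊢-mono s (¬¬E d)     = ¬¬E (⊢-mono s d)
⊢-mono s (□I d e)    = □I (⊢-mono s d) (⊢-mono (∷⁺ʳ _ s) e)
⊢-mono s (□E d)      = □E (⊢-mono s d)
⊢-mono s (¬□I d)     = ¬□I (⊢-mono s d)
⊢-mono s (¬□E d e)   = ¬□E (⊢-mono s d) (⊢-mono s e)
⊢-mono s (⊥I d)      = ⊥I (⊢-mono s d)
⊢-mono s (⊥E d)      = ⊥E (⊢-mono s d)

weaken : Γ ⊢ φ → (ψ ∷ Γ) ⊢ φ
weaken = ⊢-mono (xs⊆x∷xs _ _)

#0 : (φ ∷ Γ) ⊢ φ
#0 = ass (here refl)

#1 : (ψ ∷ φ ∷ Γ) ⊢ φ
#1 = ass (there (here refl))

#2 : (χ ∷ ψ ∷ φ ∷ Γ) ⊢ φ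
#2 = ass (there (there (here refl)))

⊣⊢-intro : (∀ {Γ} → Γ ⊢ φ → Γ ⊢ ψ) → (∀ {Γ} → Γ ⊢ ψ → Γ ⊢ φ) → φ ⊣⊢ ψ
⊣⊢-intro f g = f #0 , g #0

contradiction : Γ ⊢ ¬' φ → Γ ⊢ □ φ → Γ ⊢ χ
contradiction n b = ⊥E (⊥I (∧I n b))

Explosive : Form → Set
Explosive φ = ∀ {Γ} → Γ ⊢ φ → Γ ⊢ ¬' φ → Γ ⊢ ⊥'

explosive⇒□I : Explosive φ → Γ ⊢ φ → Γ ⊢ □ φ
explosive⇒□I e d = □I d (e (weaken d) #0)

□-explosive : Explosive (□ φ)
□-explosive d n = ⊥I (∧I (¬□E n (□E d)) d)

¬□-explosive : Explosive (¬' □ φ)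
¬□-explosive d n = □-explosive (¬¬E n) d

∧-explosive : Explosive φ → Explosive ψ → Explosive (φ ∧' ψ)
∧-explosive eφ eψ d n = ¬∧E n (eφ (weaken (∧E₁ d)) #0) (eψ (weaken (∧E₂ d)) #0)

∨-explosive : Explosive φ → Explosive ψ → Explosive (φ ∨' ψ)
∨-explosive eφ eψ d n = ∨E d (eφ #0 (¬∨E₁ (weaken n))) (eψ #0 (¬∨E₂ (weaken n)))

□⇒□□ : Γ ⊢ □ φ → Γ ⊢ □ □ φ
□⇒□□ = explosive⇒□I □-explosive

□-MA : Γ ⊢ □ (φ ∨' ¬' □ φ)
□-MA = □I MA (contradiction (¬∨E₁ #0) (¬¬E (¬∨E₂ #0)))

□-excluded-middle : Γ ⊢ □ φ ∨' ¬' □ φ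
□-excluded-middle {φ = φ} = ∨E (MA {φ = ¬' □ φ}) (∨I₂ #0) (∨E (MA {φ = φ}) holds (∨I₂ #0))
  where
  holds : (φ ∷ ¬' □ ¬' □ φ ∷ Γ) ⊢ □ φ ∨' ¬' □ φ
  holds = ∨I₁ (□I #0 (contradiction #0 (¬¬E (¬□E #2 (¬□I #0)))))

□∨¬-intro : Γ ⊢ φ → Γ ⊢ □ φ ∨' ¬' φ
□∨¬-intro d = ∨E □-excluded-middle (∨I₁ #0) (∨I₂ (¬□E #0 (weaken d)))

□∧⇒∧□ : Γ ⊢ □ (φ ∧' ψ) → Γ ⊢ □ φ ∧' □ ψ
□∧⇒∧□ d = ∧I (□I (∧E₁ (□E d)) (contradiction (¬∧I₁ #0) (weaken d)))
              (□I (∧E₂ (□E d)) (contradiction (¬∧I₂ #0) (weaken d)))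

∧□⇒□∧ : Γ ⊢ □ φ ∧' □ ψ → Γ ⊢ □ (φ ∧' ψ)
∧□⇒□∧ d = □I (∧I (□E (∧E₁ d)) (□E (∧E₂ d)))
             (¬∧E #0 (contradiction #0 (∧E₁ (weaken (weaken d))))
                     (contradiction #0 (∧E₂ (weaken (weaken d)))))

□∨□⇒∨□ : Γ ⊢ □ (φ ∨' □ ψ) → Γ ⊢ □ φ ∨' □ ψ
□∨□⇒∨□ {Γ = Γ} {φ = φ} {ψ = ψ} d =
  ∨E □-excluded-middle (∨I₂ #0) (∨E (□E (weaken d)) (∨I₁ □φ) (∨I₂ #0))
  where
  □φ : (φ ∷ ¬' □ ψ ∷ Γ) ⊢ □ φ
  □φ = □I #0 (contradiction (¬∨I #0 #2) (weaken (weaken (weaken d))))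

∨□⇒□∨□ : Γ ⊢ □ φ ∨' □ ψ → Γ ⊢ □ (φ ∨' □ ψ)
∨□⇒□∨□ d = ∨E d (□I (∨I₁ (□E #0)) (contradiction (¬∨E₁ #0) #1))
                (□I (∨I₂ #0) (contradiction (¬∨E₂ #0) (□⇒□□ #1)))

lemma3p4 : (α β : Form) →
      (⊢ □ (α ∨' ¬' □ α))
    × ((¬' □ α ∧' α) ⊣⊢ (¬' α ∧' α))
    × (⊢ □ α ∨' ¬' □ α)
    × ((□ α ∧' ¬' □ α) ⊣⊢ ⊥')
    × ((□ (□ α ∧' □ β)) ⊣⊢ (□ α ∧' □ β))
    × ((□ (□ α ∨' □ β)) ⊣⊢ (□ α ∨' □ β))
    × ((□ α ∨' ¬' α) ⊣⊢ (α ∨' ¬' α))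
    × ((□ □ α) ⊣⊢ (□ α))
    × ((□ (α ∧' β)) ⊣⊢ (□ α ∧' □ β))
    × ((□ (α ∨' □ β)) ⊣⊢ (□ α ∨' □ β))
    × ((□ ¬' □ α) ⊣⊢ (¬' □ α))
    × ((α ∧' □ ¬' α) ⊣⊢ ⊥')
lemma3p4 α β =
    □-MA
  , ⊣⊢-intro (λ d → ∧I (¬□E (∧E₁ d) (∧E₂ d)) (∧E₂ d)) (λ d → ∧I (¬□I (∧E₁ d)) (∧E₂ d))
  , □-excluded-middle
  , ⊣⊢-intro (λ d → □-explosive (∧E₁ d) (∧E₂ d)) ⊥E
  , ⊣⊢-intro □E (explosive⇒□I (∧-explosive □-explosive □-explosive))
  , ⊣⊢-intro □E (explosive⇒□I (∨-explosive □-explosive □-explosive))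
  , ⊣⊢-intro (λ d → ∨E d (∨I₁ (□E #0)) (∨I₂ #0)) (λ d → ∨E d (□∨¬-intro #0) (∨I₂ #0))
  , ⊣⊢-intro □E □⇒□□
  , ⊣⊢-intro □∧⇒∧□ ∧□⇒□∧
  , ⊣⊢-intro □∨□⇒∨□ ∨□⇒□∨□
  , ⊣⊢-intro □E (explosive⇒□I ¬□-explosive)
  , ⊣⊢-intro (λ d → ⊥I (∧I (¬¬I (∧E₁ d)) (∧E₂ d))) ⊥E
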